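{- Let $\sigma$ be a signature and let $S=(S^-,\mathcal G)$ and $T=(T^-,\mathcal F)$ be causal teams over $\sigma$ with $S^-\neq\emptyset$ and $T^-\neq\emptyset$. Then $S\models\Theta^T\wedge\Phi^{\mathcal F}$ if and only if there is a causal team $R$ over $\sigma$ with $S\approx R$ and $R$ a causal subteam of $T$.
   Context: Signature $\sigma=(\mathrm{Dom},\mathrm{Ran})$: nonempty finite set of variables, each with a nonempty finite range; $\mathrm{Ran}(\mathbf X)$ product of ranges. Assignments $s$ with $s(X)\in\mathrm{Ran}(X)$; $\mathbb A_\sigma$ their set. A system of functions $\mathcal F$ assigns to each $V\in\mathrm{En}(\mathcal F)\subseteq\mathrm{Dom}$ a set $PA_V^{\mathcal F}\subseteq\mathrm{Dom}\setminus\{V\}$ and $\mathcal F_V:\mathrm{Ran}(PA_V^{\mathcal F})\to\mathrm{Ran}(V)$; recursive if the graph with edges $(X,Y)$, $X\in PA_Y^{\mathcal F}$, is acyclic; $s$ compatible with $\mathcal F$ if $s(V)=\mathcal F_V(s(PA_V^{\mathcal F}))$ for $V\in\mathrm{En}(\mathcal F)$. $\mathrm{Cn}(\mathcal F)$: set of $V\in\mathrm{En}(\mathcal F)$ with $\mathcal F_V$ constant. Causal team: $(T^-,\mathcal F)$, $\mathcal F$ recursive, $T^-\subseteq\mathbb A_\sigma$ of compatible assignments; causal subteam: $(S^-,\mathcal F)$, $S^-\subseteq T^-$. $\mathbf X=\mathbf x$: conjunction of equations, consistent if no variable gets two distinct values. Intervention (consistent): $\mathcal F_{\mathbf X=\mathbf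 x}$ = restriction of $\mathcal F$ to $\mathrm{En}(\mathcal F)\setminus\mathbf X$; $s_{\mathbf X=\mathbf x}(X_i)=x_i$, $s_{\mathbf X=\mathbf x}(V)=s(V)$ for $V\notin\mathrm{En}(\mathcal F)\cup\mathbf X$, $s_{\mathbf X=\mathbf x}(V)=\mathcal F_V(s_{\mathbf X=\mathbf x}(PA_V^{\mathcal F}))$ recursively otherwise; $T_{\mathbf X=\mathbf x}=(\{s_{\mathbf X=\mathbf x}\mid s\in T^-\},\mathcal F_{\mathbf X=\mathbf x})$. $\mathcal{CO}[\sigma]$: $\alpha::=X=x\mid\neg\alpha\mid\alpha\wedge\alpha\mid\alpha\vee\alpha\mid\mathbf X=\mathbf x\ \Box\!\!\rightarrow\alpha$; $\alpha\supset\beta:=\neg\alpha\vee\beta$. Semantics on $T=(T^-,\mathcal F)$: $T\models X=x$ iff $s(X)=x$ for all $s\in T^-$; $T\models\neg\alpha$ iff $(\{s\},\mathcal F)\not\models\alpha$ for all $s\in T^-$; $\wedge$ usual; $T\models\varphi\vee\psi$ iff causal subteams $T_1,T_2$ with $T_1^-\cup T_2^-=T^-$, $T_1\models\varphi$, $T_2\models\psi$ exist; $T\models\mathbf X=\mathbf x\ \Box\!\!\rightarrow\varphi$ iff inconsistent or $T_{\mathbf X=\mathbf x}\models\varphi$. $\mathcal F_V\sim\mathcal G_V$ iff $\mathcal F_V(\mathbf x\mathbf y)=\mathcal G_V(\mathbf x\mathbf z)$ for all $\mathbf x\in\mathrm{Ran}(PA_V^{\mathcal F}\cap PA_V^{\mathcal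 G})$, $\mathbf y\in\mathrm{Ran}(PA_V^{\mathcal F}\setminus PA_V^{\mathcal G})$, $\mathbf z\in\mathrm{Ran}(PA_V^{\mathcal G}\setminus PA_V^{\mathcal F})$; $\mathcal F\sim\mathcal G$ iff $\mathrm{En}(\mathcal F)\setminus\mathrm{Cn}(\mathcal F)=\mathrm{En}(\mathcal G)\setminus\mathrm{Cn}(\mathcal G)$ and $\mathcal F_V\sim\mathcal G_V$ for all $V$ in this set. $(S^-,\mathcal G)\approx(R^-,\mathcal H)$ iff $\mathcal G\sim\mathcal H$ and $S^-=R^-$. $\Theta^T:=\bigvee_{s\in T^- }\bigwedge_{V\in\mathrm{Dom}}V=s(V)$. $\Phi^{\mathcal F}:=\bigwedge_{V\in\mathrm{En}(\mathcal F)}\eta(V)\wedge\bigwedge_{V\in(\mathrm{Dom}\setminus\mathrm{En}(\mathcal F))\cup\mathrm{Cn}(\mathcal F)}\xi(V)$, where $\eta(V):=\bigwedge\{(\mathbf W=\mathbf w\wedge PA_V^{\mathcal F}=\mathbf p)\ \Box\!\!\rightarrow V=\mathcal F_V(\mathbf p)\mid\mathbf W=\mathrm{Dom}\setminus(PA_V^{\mathcal F}\cup\{V\}),\mathbf w\in\mathrm{Ran}(\mathbf W),\mathbf p\in\mathrm{Ran}(PA_V^{\mathcal F})\}$ and $\xi(V):=\bigwedge\{V=v\supset(\mathbf W_V=\mathbf w\ \Box\!\!\rightarrow V=v)\mid v\in\mathrm{Ran}(V),\mathbf W_V=\mathrm{Dom}\setminus\{V\},\mathbf w\in\mathrm{Ran}(\mathbf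 W_V)\}$. -}

module Defs where

open import Data.Nat using (ℕ; zero; suc)
open import Data.Fin using (Fin; zero; suc; _≟_)
open import Data.Bool using (Bool; true; false; T; T?; _∧_; _∨_; not; if_then_else_)
open import Data.Bool.ListAction using (and)
open import Data.List using (List; []; _∷_; _++_; map; concatMap; filter; allFin)
open import Data.List.Relation.Unary.All using (All)
open import Data.List.Relation.Unary.Any using (Any)
open import Data.Maybe using (Maybe; just; nothing; is-just)
open import Data.Product using (Σ; ∃; _×_; _,_; proj₁; proj₂)
open import Data.Sum using (_⊎_)
open import Data.Empty using (⊥)
open import Function using (id)
open import Function.Bundles using (_⇔_)
open import Relation.Nullary using (¬_; does; yes; no)
open import Relation.Binary.PropositionalEquality using (_≡_; refl)
open import Relation.Binary.Construct.Closure.Transitive using (TransClosure)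

record Signature : Set where
  field
    m : ℕ
    r : Fin (suc m) → ℕ

module _ (σ : Signature) where
  open Signature σ

  Var : Set
  Var = Fin (suc m)

  Ran : Var → Set
  Ran X = Fin (suc (r X))

  Asg : Set
  Asg = (X : Var) → Ran X

  _≐_ : Asg → Asg → Set
  s ≐ t = ∀ X → s X ≡ t X

  _∈T_ : Asg → List Asg → Set
  s ∈T L = Any (λ t → s ≐ t) L

  _⊆T_ : List Asg → List Asg → Set
  L ⊆T L' = ∀ s → s ∈T L → s ∈T L'

  _=T_ : List Asg → List Asg → Set
  L =T L' = (L ⊆T L') × (L' ⊆T L)

  -- En : the endogenous variables; PA V : the parent set of V;
  -- F V : Asg → Ran V is F_V, required (for V ∈ En) to depend only on PA_V,
  -- i.e. it represents a function Ran(PA_V) → Ran(V).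
  -- For V ∉ En the components PA V, F V are irrelevant junk.

  record System : Set where
    field
      En : Var → Bool
      PA : Var → Var → Bool      -- PA V X = true  iff  X ∈ PA_V
      F  : (V : Var) → Asg → Ran V

  open System public

  WellFormed : System → Set
  WellFormed 𝓕 =
      (∀ V → T (En 𝓕 V) → PA 𝓕 V V ≡ false)
    × (∀ V → T (En 𝓕 V) → ∀ s t → (∀ X → T (PA 𝓕 V X) → s X ≡ t X) → F 𝓕 V s ≡ F 𝓕 V t)

  Edge : System → Var → Var → Set
  Edge 𝓕 X Y = T (En 𝓕 Y) × T (PA 𝓕 Y X)

  Recursive : System → Set
  Recursive 𝓕 = ∀ X → ¬ TransClosure (Edge 𝓕) X X

  Compatible : System → Asg → Set
  Compatible 𝓕 s = ∀ V → T (En 𝓕 V) → s V ≡ F 𝓕 V s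

  record CausalTeam : Set where
    field
      team   : List Asg
      sys    : System
      wf     : WellFormed sys
      rec    : Recursive sys
      compat : All (Compatible sys) team

  open CausalTeam public

  Subteam : CausalTeam → CausalTeam → Set
  Subteam R U = (sys R ≡ sys U) × (team R ⊆T team U)

  allAsg' : (k : ℕ) (ρ : Fin k → ℕ) → List ((X : Fin k) → Fin (suc (ρ X)))
  allAsg' zero ρ = (λ ()) ∷ []
  allAsg' (suc k) ρ =
    concatMap (λ x → map (λ f → cons x f) (allAsg' k (λ i → ρ (suc i))))
              (allFin (suc (ρ zero)))
    where
    cons : Fin (suc (ρ zero)) → ((X : Fin k) → Fin (suc (ρ (suc X))))
         → (X : Fin (suc k)) → Fin (suc (ρ X))
    cons x f zero = x
    cons x f (suc i) = f i

  allAsg : List Asg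
  allAsg = allAsg' (suc m) r

  isConst : System → Var → Bool
  isConst 𝓕 V = and (concatMap (λ a → map (λ b → does (F 𝓕 V a ≟ F 𝓕 V b)) allAsg) allAsg)

  inCn : System → Var → Bool
  inCn 𝓕 V = En 𝓕 V ∧ isConst 𝓕 V

  Eqn : Set
  Eqn = Σ Var Ran

  infixr 6 _∧ᶠ_
  infixr 5 _∨ᶠ_
  infixr 4 _□→_

  data Fm : Set where
    eq    : (X : Var) → Ran X → Fm
    ¬ᶠ_   : Fm → Fm
    _∧ᶠ_  : Fm → Fm → Fm
    _∨ᶠ_  : Fm → Fm → Fm
    _□→_  : List Eqn → Fm → Fm

  _⊃_ : Fm → Fm → Fm
  α ⊃ β = (¬ᶠ α) ∨ᶠ β

  _∈E_ : Eqn → List Eqn → Set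
  e ∈E es = Any (λ e' → e ≡ e') es

  Consistent : List Eqn → Set
  Consistent es = ∀ X (x x' : Ran X) → (X , x) ∈E es → (X , x') ∈E es → x ≡ x'

  lookupE : List Eqn → (V : Var) → Maybe (Ran V)
  lookupE [] V = nothing
  lookupE ((X , x) ∷ es) V with X ≟ V
  ... | yes refl = just x
  ... | no _ = lookupE es V

  inE : List Eqn → Var → Bool
  inE es V = is-just (lookupE es V)

  intervSys : System → List Eqn → System
  intervSys 𝓕 es = record { En = λ V → En 𝓕 V ∧ not (inE es V) ; PA = PA 𝓕 ; F = F 𝓕 }

  step : System → List Eqn → Asg → Asg → Asg
  step 𝓕 es s t V with lookupE es V
  ... | just x = x
  ... | nothing = if En 𝓕 V then F 𝓕 V t else s V

  iter : ℕ → (Asg → Asg) → Asg → Asg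
  iter zero g t = t
  iter (suc k) g t = g (iter k g t)

  -- s_{X=x}: for a recursive system the recursion reaches its (unique)
  -- fixed point after |Dom| = suc m rounds
  intervAsg : System → List Eqn → Asg → Asg
  intervAsg 𝓕 es s = iter (suc m) (step 𝓕 es s) s

  _,_⊨_ : List Asg → System → Fm → Set
  L , 𝓕 ⊨ eq X x = All (λ s → s X ≡ x) L
  L , 𝓕 ⊨ (¬ᶠ α) = All (λ s → ¬ ((s ∷ []) , 𝓕 ⊨ α)) L
  L , 𝓕 ⊨ (α ∧ᶠ β) = (L , 𝓕 ⊨ α) × (L , 𝓕 ⊨ β)
  L , 𝓕 ⊨ (α ∨ᶠ β) = Σ (List Asg) λ L₁ → Σ (List Asg) λ L₂ →
      (L₁ ⊆T L) × (L₂ ⊆T L) × (∀ s → s ∈T L → (s ∈T L₁) ⊎ (s ∈T L₂))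
    × (L₁ , 𝓕 ⊨ α) × (L₂ , 𝓕 ⊨ β)
  L , 𝓕 ⊨ (es □→ α) = (¬ Consistent es) ⊎ (map (intervAsg 𝓕 es) L , intervSys 𝓕 es ⊨ α)

  -- big conjunctions / disjunctions (only used on nonempty lists;
  -- the [] case is an arbitrary junk value)

  ⋀ : List Fm → Fm
  ⋀ [] = eq zero zero
  ⋀ (φ ∷ []) = φ
  ⋀ (φ ∷ ψ ∷ ψs) = φ ∧ᶠ ⋀ (ψ ∷ ψs)

  ⋁ : List Fm → Fm
  ⋁ [] = eq zero zero
  ⋁ (φ ∷ []) = φ
  ⋁ (φ ∷ ψ ∷ ψs) = φ ∨ᶠ ⋁ (ψ ∷ ψs)

  allVar : List Var
  allVar = allFin (suc m)

  eqnsOf : List Var → Asg → List Eqn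
  eqnsOf Ys a = map (λ Y → (Y , a Y)) Ys

  Θ : CausalTeam → Fm
  Θ U = ⋁ (map (λ s → ⋀ (map (λ V → eq V (s V)) allVar)) (team U))

  varsWhere : (Var → Bool) → List Var
  varsWhere P = filter (λ V → T? (P V)) allVar

  -- η(V): W = Dom \ (PA_V ∪ {V}), W = w ∧ PA_V = p, for all w, p
  -- (the pairs (w , p) are enumerated as restrictions of all assignments a)
  η : System → Var → Fm
  η 𝓕 V = ⋀ (map (λ a → (eqnsOf Wv a ++ eqnsOf Pv a) □→ eq V (F 𝓕 V a)) allAsg)
    where
    Wv = varsWhere (λ X → not (PA 𝓕 V X) ∧ not (does (X ≟ V)))
    Pv = varsWhere (λ X → PA 𝓕 V X)

  ξ : Var → Fm
  ξ V = ⋀ (concatMap (λ v → map (λ a → eq V v ⊃ (eqnsOf Wv a □→ eq V v)) allAsg)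
                     (allFin (suc (r V))))
    where
    Wv = varsWhere (λ X → not (does (X ≟ V)))

  Φ : System → Fm
  Φ 𝓕 = ⋀ (map (η 𝓕) (varsWhere (En 𝓕))
        ++ map ξ (varsWhere (λ V → not (En 𝓕 V) ∨ inCn 𝓕 V)))

  _∼V_at_ : System → System → Var → Set
  𝓕 ∼V 𝓖 at V = ∀ s t → (∀ X → T (PA 𝓕 V X) → T (PA 𝓖 V X) → s X ≡ t X)
                       → F 𝓕 V s ≡ F 𝓖 V t

  nonConst : System → Var → Bool
  nonConst 𝓕 V = En 𝓕 V ∧ not (inCn 𝓕 V)

  _∼_ : System → System → Set
  𝓕 ∼ 𝓖 = (∀ V → nonConst 𝓕 V ≡ nonConst 𝓖 V)
         × (∀ V → T (nonConst 𝓕 V) → 𝓕 ∼V 𝓖 at V)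

  _≈_ : CausalTeam → CausalTeam → Set
  S ≈ R = (sys S ∼ sys R) × (team S =T team R)

-- Θ^T holds in S exactly when every assignment of S occurs in T.  On a nonempty team S, Φ^F probes
-- each variable V by the intervention fixing all other variables to the values of an arbitrary
-- assignment a.  For V endogenous in F, η(V) asks the outcome to be F_V(a): if F_V is not constant,
-- this forces V to be endogenous in S's system with the same law; if F_V is constant, it forces V to
-- be exogenous or constant there too.  For V exogenous or constant in F, ξ(V) asks the intervention
-- to leave V unchanged, which forces V to be exogenous or constant in S's system as well.  Together
-- this is exactly the similarity of the two systems.  Conversely, similarity and S^- ⊆ T^- make every
-- probe return the predicted value, and the witness R is S^- equipped with the system of T.

module Submission where

open import Defs
open import Data.Nat using (ℕ; zero; suc; pred)
open import Data.Fin using (Fin; zero; suc; _≟_)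
open import Data.Fin.Properties using (all?)
open import Data.Bool using (Bool; true; false; T; T?; _∧_; _∨_; not; if_then_else_)
open import Data.Bool.Properties using (T-≡; T-∧; T-not-≡; if-cong; not-injective)
open import Data.Bool.ListAction using (and)
open import Data.List using (List; []; _∷_; _++_; map; concatMap; filter; allFin)
open import Data.List.Properties using (map-++)
open import Data.List.Relation.Unary.All as All using (All; []; _∷_)
open import Data.List.Relation.Unary.Any as Any using (Any; here; there)
import Data.List.Relation.Unary.All.Properties as All
import Data.List.Relation.Unary.Any.Properties as Any
open import Data.List.Membership.Propositional using (_∈_; _∉_; find)
open import Data.List.Membership.Propositional.Properties
  using (∈-map⁺; ∈-filter⁺; ∈-filter⁻; ∈-allFin; ∈-++⁺ˡ; ∈-++⁺ʳ; ∈-++⁻; ∈-concatMap⁺)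
open import Data.Maybe using (just; nothing)
open import Data.Product using (Σ; ∃; _×_; _,_; proj₁; proj₂)
open import Data.Sum using (_⊎_; inj₁; inj₂; [_,_])
open import Function using (_∘_; const)
open import Function.Bundles using (_⇔_; mk⇔; Equivalence)
open import Relation.Nullary using (¬_; ¬?; Dec; does; yes; no; contradiction)
open import Relation.Nullary.Decidable using (decidable-stable)
open import Relation.Unary using (Decidable)
open import Relation.Unary.Properties using (∁?)
open import Relation.Binary.PropositionalEquality
  using (_≡_; _≢_; refl; sym; trans; cong; subst; module ≡-Reasoning)

open Equivalence using (to; from)

T-does : ∀ {P : Set} (d : Dec P) → T (does d) ⇔ P
T-does (yes p) = mk⇔ (const p) (const _)
T-does (no ¬p) = mk⇔ (λ ()) (λ p → ¬p p)

T-not : ∀ {b} → T (not b) ⇔ (¬ T b)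
T-not {false} = mk⇔ (λ _ ()) (const _)
T-not {true} = mk⇔ (λ ()) (λ ¬t → ¬t _)

T-and : ∀ (bs : List Bool) → T (and bs) ⇔ All T bs
T-and bs = mk⇔ (and⁻ bs) and⁺
  where
  and⁻ : ∀ bs → T (and bs) → All T bs
  and⁻ [] _ = []
  and⁻ (b ∷ bs) t = proj₁ (to T-∧ t) ∷ and⁻ bs (proj₂ (to T-∧ t))
  and⁺ : ∀ {bs} → All T bs → T (and bs)
  and⁺ [] = _
  and⁺ (t ∷ ts) = from T-∧ (t , and⁺ ts)

T-⇔⇒≡ : ∀ {x y} → T x ⇔ T y → x ≡ y
T-⇔⇒≡ {false} {false} _ = refl
T-⇔⇒≡ {false} {true} h = contradiction _ (from h)
T-⇔⇒≡ {true} {false} h = contradiction _ (to h)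
T-⇔⇒≡ {true} {true} _ = refl

≢[]⇒∃∈ : ∀ {A : Set} {xs : List A} → ¬ xs ≡ [] → ∃ (_∈ xs)
≢[]⇒∃∈ {xs = []} xs≢[] = contradiction refl xs≢[]
≢[]⇒∃∈ {xs = x ∷ _} _ = x , here refl

distinct⇒suc-pred : ∀ {n} {X Y : Fin (suc n)} → X ≢ Y → n ≡ suc (pred n)
distinct⇒suc-pred {zero} {zero} {zero} X≢Y = contradiction refl X≢Y
distinct⇒suc-pred {suc n} _ = refl

module _ (σ : Signature) where
  open Signature σ

  ≐-trans : ∀ {s t u : Asg σ} → _≐_ σ s t → _≐_ σ t u → _≐_ σ s u
  ≐-trans p q X = trans (p X) (q X)

  ≐? : (s t : Asg σ) → Dec (_≐_ σ s t)
  ≐? s t = all? (λ X → s X ≟ t X)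

  ∈⇒∈T : ∀ {s L} → s ∈ L → _∈T_ σ s L
  ∈⇒∈T = Any.map (λ { refl _ → refl })

  ∈T-resp-≐ : ∀ {s t L} → _≐_ σ s t → _∈T_ σ t L → _∈T_ σ s L
  ∈T-resp-≐ s≐t = Any.map (≐-trans s≐t)

  ⊆T-refl : ∀ {L} → _⊆T_ σ L L
  ⊆T-refl _ s∈ = s∈

  ⊆T-trans : ∀ {L L′ L″} → _⊆T_ σ L L′ → _⊆T_ σ L′ L″ → _⊆T_ σ L L″
  ⊆T-trans p q s = q s ∘ p s

  allAsg'-complete : ∀ k (ρ : Fin k → ℕ) (f : (X : Fin k) → Fin (suc (ρ X)))
                   → Any (λ g → ∀ X → f X ≡ g X) (allAsg' σ k ρ)
  allAsg'-complete zero ρ f = here (λ ())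
  allAsg'-complete (suc k) ρ f =
    Any.concatMap⁺ _ (Any.map (λ { refl → Any.map⁺ (Any.map (λ eq → λ { zero → refl ; (suc i) → eq i })
                                   (allAsg'-complete k (λ i → ρ (suc i)) (λ i → f (suc i)))) })
                            (∈-allFin (f zero)))

  ∈T-allAsg : ∀ a → _∈T_ σ a (allAsg σ)
  ∈T-allAsg = allAsg'-complete (suc m) r

  allAsg-nonempty : ∃ (_∈ allAsg σ)
  allAsg-nonempty = let a , a∈ , _ = find (∈T-allAsg (λ _ → zero)) in a , a∈

  ∈-varsWhere : ∀ {X} P → X ∈ varsWhere σ P ⇔ T (P X)
  ∈-varsWhere {X} P =
    mk⇔ (proj₂ ∘ ∈-filter⁻ (T? ∘ P) {xs = allVar σ}) (∈-filter⁺ (T? ∘ P) (∈-allFin X))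

  F-resp-≐ : ∀ {𝓕 V s t} → WellFormed σ 𝓕 → T (En 𝓕 V) → _≐_ σ s t → F 𝓕 V s ≡ F 𝓕 V t
  F-resp-≐ (_ , local) en s≐t = local _ en _ _ (λ X _ → s≐t X)

  Compatible-resp-≐ : ∀ {𝓕 s t} → WellFormed σ 𝓕 → _≐_ σ s t → Compatible σ 𝓕 t → Compatible σ 𝓕 s
  Compatible-resp-≐ wf s≐t ct V en =
    trans (s≐t V) (trans (ct V en) (F-resp-≐ wf en (λ X → sym (s≐t X))))

  ∈T⇒Compatible : ∀ (U : CausalTeam σ) {s} → _∈T_ σ s (team U) → Compatible σ (sys U) s
  ∈T⇒Compatible U s∈ = let u , u∈ , s≐u = find s∈ in
    Compatible-resp-≐ (wf U) s≐u (All.lookup (compat U) u∈)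

  T-isConst : ∀ {𝓕 V} → T (isConst σ 𝓕 V)
              ⇔ (∀ {a b} → a ∈ allAsg σ → b ∈ allAsg σ → F 𝓕 V a ≡ F 𝓕 V b)
  T-isConst {𝓕} {V} = mk⇔
    (λ c {a} {b} a∈ b∈ → to (T-does (F 𝓕 V a ≟ F 𝓕 V b))
       (All.lookup (All.map⁻ (All.lookup (All.map⁻ (All.concat⁻ (to (T-and _) c))) a∈)) b∈))
    (λ h → from (T-and _) (All.concat⁺ (All.map⁺ (All.tabulate λ a∈ →
                             All.map⁺ (All.tabulate λ b∈ → from (T-does (_ ≟ _)) (h a∈ b∈))))))

  isConst-intro : ∀ {𝓕 V} (c : Ran σ V) → (∀ {a} → a ∈ allAsg σ → F 𝓕 V a ≡ c) → T (isConst σ 𝓕 V)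
  isConst-intro {𝓕} {V} c h = from (T-isConst {𝓕} {V}) (λ a∈ b∈ → trans (h a∈) (sym (h b∈)))

  isConst⇒constant : ∀ {𝓕 V} → WellFormed σ 𝓕 → T (En 𝓕 V) → T (isConst σ 𝓕 V)
                   → ∀ a b → F 𝓕 V a ≡ F 𝓕 V b
  isConst⇒constant {𝓕} {V} wf en c a b =
    let a′ , a′∈ , a≐a′ = find (∈T-allAsg a) ; b′ , b′∈ , b≐b′ = find (∈T-allAsg b) in
    trans (F-resp-≐ wf en a≐a′)
          (trans (to (T-isConst {𝓕} {V}) c a′∈ b′∈) (sym (F-resp-≐ wf en b≐b′)))

  compatible-constant : ∀ {𝓕 V s} a → WellFormed σ 𝓕 → Compatible σ 𝓕 s → T (En 𝓕 V)
                      → T (isConst σ 𝓕 V) → s V ≡ F 𝓕 V a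
  compatible-constant a wf cs en c = trans (cs _ en) (isConst⇒constant wf en c _ a)

  exoOrConst : System σ → Var σ → Bool
  exoOrConst 𝓕 V = not (En 𝓕 V) ∨ inCn σ 𝓕 V

  exoOrConst-exo : ∀ {𝓕 V} → ¬ T (En 𝓕 V) → T (exoOrConst 𝓕 V)
  exoOrConst-exo {𝓕} {V} exo with En 𝓕 V
  ... | false = _
  ... | true = contradiction _ exo

  exoOrConst-endo : ∀ {𝓕 V} → T (En 𝓕 V) → exoOrConst 𝓕 V ≡ isConst σ 𝓕 V
  exoOrConst-endo {𝓕} {V} en with En 𝓕 V
  ... | true = refl

  isConst⇒exoOrConst : ∀ {𝓕 V} → T (isConst σ 𝓕 V) → T (exoOrConst 𝓕 V)
  isConst⇒exoOrConst {𝓕} {V} c with T? (En 𝓕 V)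
  ... | yes en = subst T (sym (exoOrConst-endo {𝓕} en)) c
  ... | no exo = exoOrConst-exo {𝓕} exo

  exoOrConst⇒isConst : ∀ {𝓕 V} → T (En 𝓕 V) → T (exoOrConst 𝓕 V) → T (isConst σ 𝓕 V)
  exoOrConst⇒isConst {𝓕} en = subst T (exoOrConst-endo {𝓕} en)

  nonConst≡not-exoOrConst : ∀ 𝓕 V → nonConst σ 𝓕 V ≡ not (exoOrConst 𝓕 V)
  nonConst≡not-exoOrConst 𝓕 V with En 𝓕 V
  ... | false = refl
  ... | true = refl

  T-nonConst : ∀ {𝓕 V} → T (nonConst σ 𝓕 V) ⇔ (¬ T (exoOrConst 𝓕 V))
  T-nonConst {𝓕} {V} rewrite nonConst≡not-exoOrConst 𝓕 V = T-not

  nonConst≡⇔exoOrConst≡ : ∀ {𝓕 𝓖 V}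
                        → nonConst σ 𝓕 V ≡ nonConst σ 𝓖 V ⇔ exoOrConst 𝓕 V ≡ exoOrConst 𝓖 V
  nonConst≡⇔exoOrConst≡ {𝓕} {𝓖} {V}
    rewrite nonConst≡not-exoOrConst 𝓕 V | nonConst≡not-exoOrConst 𝓖 V = mk⇔ not-injective (cong not)

  record FixesAllBut (es : List (Eqn σ)) (V : Var σ) (a : Asg σ) : Set where
    field
      free  : lookupE σ es V ≡ nothing
      fixed : ∀ X → X ≢ V → lookupE σ es X ≡ just (a X)

  module _ {𝓕 : System σ} {es : List (Eqn σ)} where

    step-at-free : ∀ {s t} V → lookupE σ es V ≡ nothing
                 → step σ 𝓕 es s t V ≡ (if En 𝓕 V then F 𝓕 V t else s V)
    step-at-free V free with lookupE σ es V
    ... | nothing = refl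

    step-at-fixed : ∀ {s t} X {x} → lookupE σ es X ≡ just x → step σ 𝓕 es s t X ≡ x
    step-at-fixed X fixed with lookupE σ es X
    step-at-fixed X refl | just x = refl

    intervAsg-exogenous : ∀ {V a s} → FixesAllBut es V a → ¬ T (En 𝓕 V) → intervAsg σ 𝓕 es s V ≡ s V
    intervAsg-exogenous {V} fixes exo =
      trans (step-at-free V (FixesAllBut.free fixes)) (if-cong (to T-not-≡ (from T-not exo)))

    intervAsg-endogenous : ∀ {V a s} → WellFormed σ 𝓕 → FixesAllBut es V a → T (En 𝓕 V)
                         → intervAsg σ 𝓕 es s V ≡ F 𝓕 V a
    intervAsg-endogenous {V} {a} {s} (irreflexive , local) fixes en = begin
      intervAsg σ 𝓕 es s V              ≡⟨ step-at-free V (FixesAllBut.free fixes) ⟩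
      (if En 𝓕 V then F 𝓕 V w else s V) ≡⟨ if-cong (to T-≡ en) ⟩
      F 𝓕 V w                           ≡⟨ local V en w a parents-fixed ⟩
      F 𝓕 V a                           ∎
      where
      open ≡-Reasoning
      g = step σ 𝓕 es s
      w = iter σ m g s
      -- A parent X differs from V, so Dom has two elements and the last round is preceded by
      -- another, after which X already carries its value from a.
      parents-fixed : ∀ X → T (PA 𝓕 V X) → w X ≡ a X
      parents-fixed X X∈PA =
        trans (cong (λ k → iter σ k g s X) (distinct⇒suc-pred X≢V))
              (step-at-fixed X (FixesAllBut.fixed fixes X X≢V))
        where
        X≢V : X ≢ V
        X≢V refl = subst T (irreflexive V en) X∈PA

    step-resp-≐ : ∀ {s s′ t t′} → WellFormed σ 𝓕 → _≐_ σ s s′ → _≐_ σ t t′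
                → _≐_ σ (step σ 𝓕 es s t) (step σ 𝓕 es s′ t′)
    step-resp-≐ wf s≐s′ t≐t′ V with lookupE σ es V
    ... | just x = refl
    ... | nothing = free-value-resp
      where
      free-value-resp : (if En 𝓕 V then F 𝓕 V _ else _) ≡ (if En 𝓕 V then F 𝓕 V _ else _)
      free-value-resp with En 𝓕 V in en
      ... | true = F-resp-≐ wf (from T-≡ en) t≐t′
      ... | false = s≐s′ V

    intervAsg-resp-≐ : ∀ {s s′} → WellFormed σ 𝓕 → _≐_ σ s s′
                     → _≐_ σ (intervAsg σ 𝓕 es s) (intervAsg σ 𝓕 es s′)
    intervAsg-resp-≐ {s} {s′} wf s≐s′ = iter-resp (suc m)
      where
      iter-resp : ∀ k → _≐_ σ (iter σ k (step σ 𝓕 es s) s) (iter σ k (step σ 𝓕 es s′) s′)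
      iter-resp zero = s≐s′
      iter-resp (suc k) = step-resp-≐ wf s≐s′ (iter-resp k)

    intervAsg-exoOrConst : ∀ {V a s} → WellFormed σ 𝓕 → Compatible σ 𝓕 s → T (exoOrConst 𝓕 V)
                         → FixesAllBut es V a → intervAsg σ 𝓕 es s V ≡ s V
    intervAsg-exoOrConst {V} wf cs eoc fixes with T? (En 𝓕 V)
    ... | yes en = trans (intervAsg-endogenous wf fixes en)
                         (sym (compatible-constant _ wf cs en (exoOrConst⇒isConst {𝓕} en eoc)))
    ... | no exo = intervAsg-exogenous fixes exo

  ∈E-eqnsOf : ∀ Ys {a X} {x : Ran σ X} → _∈E_ σ (X , x) (eqnsOf σ Ys a) → x ≡ a X
  ∈E-eqnsOf (Y ∷ Ys) (here refl) = refl
  ∈E-eqnsOf (Y ∷ Ys) (there e∈) = ∈E-eqnsOf Ys e∈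

  eqnsOf-consistent : ∀ Ys {a} → Consistent σ (eqnsOf σ Ys a)
  eqnsOf-consistent Ys X x x′ e∈ e′∈ = trans (∈E-eqnsOf Ys e∈) (sym (∈E-eqnsOf Ys e′∈))

  lookupE-eqnsOf-∈ : ∀ Ys {a X} → X ∈ Ys → lookupE σ (eqnsOf σ Ys a) X ≡ just (a X)
  lookupE-eqnsOf-∈ (Y ∷ Ys) {X = X} X∈ with Y ≟ X | X∈
  ... | yes refl | _ = refl
  ... | no Y≢X | here refl = contradiction refl Y≢X
  ... | no Y≢X | there X∈Ys = lookupE-eqnsOf-∈ Ys X∈Ys

  lookupE-eqnsOf-∉ : ∀ Ys {a X} → X ∉ Ys → lookupE σ (eqnsOf σ Ys a) X ≡ nothing
  lookupE-eqnsOf-∉ [] X∉ = refl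
  lookupE-eqnsOf-∉ (Y ∷ Ys) {X = X} X∉ with Y ≟ X
  ... | yes refl = contradiction (here refl) X∉
  ... | no _ = lookupE-eqnsOf-∉ Ys (X∉ ∘ there)

  eqnsOf-fixesAllBut : ∀ Ys {V a} → V ∉ Ys → (∀ X → X ≢ V → X ∈ Ys) → FixesAllBut (eqnsOf σ Ys a) V a
  eqnsOf-fixesAllBut Ys V∉ others∈ = record
    { free = lookupE-eqnsOf-∉ Ys V∉
    ; fixed = λ X X≢V → lookupE-eqnsOf-∈ Ys (others∈ X X≢V) }

  others : Var σ → Var σ → Bool
  others V X = not (does (X ≟ V))

  T-others : ∀ V X → T (others V X) ⇔ (X ≢ V)
  T-others V X = mk⇔ (λ t X≡V → to T-not t (from (T-does (X ≟ V)) X≡V))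
                     (λ X≢V → from T-not (X≢V ∘ to (T-does (X ≟ V))))

  ξEqns : Var σ → Asg σ → List (Eqn σ)
  ξEqns V a = eqnsOf σ (varsWhere σ (others V)) a

  ξEqns-consistent : ∀ V a → Consistent σ (ξEqns V a)
  ξEqns-consistent V a = eqnsOf-consistent (varsWhere σ (others V))

  ξEqns-fixesAllBut : ∀ {V a} → FixesAllBut (ξEqns V a) V a
  ξEqns-fixesAllBut {V} = eqnsOf-fixesAllBut (varsWhere σ (others V))
    (λ V∈ → to (T-others V V) (to (∈-varsWhere (others V)) V∈) refl)
    (λ X X≢V → from (∈-varsWhere (others V)) (from (T-others V X) X≢V))

  nonParents : System σ → Var σ → Var σ → Bool
  nonParents 𝓕 V X = not (PA 𝓕 V X) ∧ others V X

  ηVars : System σ → Var σ → List (Var σ)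
  ηVars 𝓕 V = varsWhere σ (nonParents 𝓕 V) ++ varsWhere σ (PA 𝓕 V)

  ηEqns : System σ → Var σ → Asg σ → List (Eqn σ)
  ηEqns 𝓕 V a = eqnsOf σ (varsWhere σ (nonParents 𝓕 V)) a ++ eqnsOf σ (varsWhere σ (PA 𝓕 V)) a

  ηEqns≡eqnsOf-ηVars : ∀ 𝓕 V a → ηEqns 𝓕 V a ≡ eqnsOf σ (ηVars 𝓕 V) a
  ηEqns≡eqnsOf-ηVars 𝓕 V a = sym (map-++ _ (varsWhere σ (nonParents 𝓕 V)) (varsWhere σ (PA 𝓕 V)))

  ηEqns-consistent : ∀ 𝓕 V a → Consistent σ (ηEqns 𝓕 V a)
  ηEqns-consistent 𝓕 V a = subst (Consistent σ) (sym (ηEqns≡eqnsOf-ηVars 𝓕 V a)) (eqnsOf-consistent _)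

  ηEqns-fixesAllBut : ∀ {𝓕 V a} → PA 𝓕 V V ≡ false → FixesAllBut (ηEqns 𝓕 V a) V a
  ηEqns-fixesAllBut {𝓕} {V} {a} irreflexive =
    subst (λ es → FixesAllBut es V a) (sym (ηEqns≡eqnsOf-ηVars 𝓕 V a))
          (eqnsOf-fixesAllBut (ηVars 𝓕 V) V∉ others∈)
    where
    V∉ : V ∉ ηVars 𝓕 V
    V∉ V∈ with ∈-++⁻ (varsWhere σ (nonParents 𝓕 V)) V∈
    ... | inj₁ V∈W = to (T-others V V)
                        (proj₂ (to (T-∧ {not (PA 𝓕 V V)}) (to (∈-varsWhere (nonParents 𝓕 V)) V∈W))) refl
    ... | inj₂ V∈P = subst T irreflexive (to (∈-varsWhere (PA 𝓕 V)) V∈P)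
    others∈ : ∀ X → X ≢ V → X ∈ ηVars 𝓕 V
    others∈ X X≢V with T? (PA 𝓕 V X)
    ... | yes X∈PA = ∈-++⁺ʳ (varsWhere σ (nonParents 𝓕 V)) (from (∈-varsWhere (PA 𝓕 V)) X∈PA)
    ... | no X∉PA = ∈-++⁺ˡ (from (∈-varsWhere (nonParents 𝓕 V))
                                  (from T-∧ (from T-not X∉PA , from (T-others V X) X≢V)))

  ⊨-⋀ : ∀ {L 𝓕 φ} φs → φ ∈ φs → _,_⊨_ σ L 𝓕 (⋀ σ φs) ⇔ All (_,_⊨_ σ L 𝓕) φs
  ⊨-⋀ {L} {𝓕} (φ ∷ φs) _ = mk⇔ (⋀⁻ φ φs) (⋀⁺ φ φs)
    where
    ⋀⁻ : ∀ φ φs → _,_⊨_ σ L 𝓕 (⋀ σ (φ ∷ φs)) → All (_,_⊨_ σ L 𝓕) (φ ∷ φs)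
    ⋀⁻ φ [] p = p ∷ []
    ⋀⁻ φ (ψ ∷ ψs) (p , q) = p ∷ ⋀⁻ ψ ψs q
    ⋀⁺ : ∀ φ φs → All (_,_⊨_ σ L 𝓕) (φ ∷ φs) → _,_⊨_ σ L 𝓕 (⋀ σ (φ ∷ φs))
    ⋀⁺ φ [] (p ∷ []) = p
    ⋀⁺ φ (ψ ∷ ψs) (p ∷ ps) = p , ⋀⁺ ψ ψs ps

  ⊨-∨-filter : ∀ {𝓕 L} {P : Asg σ → Set} (P? : Decidable P) {φ ψ}
             → _,_⊨_ σ (filter P? L) 𝓕 φ → _,_⊨_ σ (filter (∁? P?) L) 𝓕 ψ → _,_⊨_ σ L 𝓕 (φ ∨ᶠ ψ)
  ⊨-∨-filter {L = L} P? ⊨φ ⊨ψ =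
      filter P? L , filter (∁? P?) L , (λ _ → Any.filter⁻ P?) , (λ _ → Any.filter⁻ (∁? P?))
    , cover , ⊨φ , ⊨ψ
    where
    cover : ∀ s → _∈T_ σ s L → _∈T_ σ s (filter P? L) ⊎ _∈T_ σ s (filter (∁? P?) L)
    cover s s∈ with find s∈
    ... | t , t∈ , s≐t with P? t
    ...   | yes Pt = inj₁ (∈T-resp-≐ s≐t (∈⇒∈T (∈-filter⁺ P? t∈ Pt)))
    ...   | no ¬Pt = inj₂ (∈T-resp-≐ s≐t (∈⇒∈T (∈-filter⁺ (∁? P?) t∈ ¬Pt)))

  point : Asg σ → Fm σ
  point t = ⋀ σ (map (λ V → eq V (t V)) (allVar σ))

  ⊨-point : ∀ {L 𝓕 t} → _,_⊨_ σ L 𝓕 (point t) ⇔ All (λ s → _≐_ σ s t) L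
  ⊨-point {t = t} = mk⇔
    (λ ⊨t → let ⊨eqs = All.map⁻ (to (⊨-⋀ _ zero∈) ⊨t) in
            All.tabulate λ s∈ V → All.lookup (All.lookup ⊨eqs (∈-allFin V)) s∈)
    (λ ≐t → from (⊨-⋀ _ zero∈) (All.map⁺ (All.tabulate λ {V} _ → All.map (λ s≐t → s≐t V) ≐t)))
    where
    zero∈ = ∈-map⁺ (λ V → eq V (t V)) (∈-allFin zero)

  ⊨-point⇒≐ : ∀ {L 𝓕 s t} → _,_⊨_ σ L 𝓕 (point t) → _∈T_ σ s L → _≐_ σ s t
  ⊨-point⇒≐ ⊨t s∈ = let u , u∈ , s≐u = find s∈ in ≐-trans s≐u (All.lookup (to ⊨-point ⊨t) u∈)

  ⊨-points : ∀ {L 𝓕} t ts → _,_⊨_ σ L 𝓕 (⋁ σ (map point (t ∷ ts))) ⇔ _⊆T_ σ L (t ∷ ts)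
  ⊨-points t [] = mk⇔ (λ ⊨t s s∈ → here (⊨-point⇒≐ ⊨t s∈))
                      (λ L⊆ → from ⊨-point (All.tabulate λ s∈ → single (L⊆ _ (∈⇒∈T s∈))))
    where
    single : ∀ {s} → _∈T_ σ s (t ∷ []) → _≐_ σ s t
    single (here s≐t) = s≐t
  ⊨-points {L} {𝓕} t (t′ ∷ ts) = mk⇔ split⇒⊆ ⊆⇒split
    where
    split⇒⊆ : _,_⊨_ σ L 𝓕 (⋁ σ (map point (t ∷ t′ ∷ ts))) → _⊆T_ σ L (t ∷ t′ ∷ ts)
    split⇒⊆ (L₁ , L₂ , _ , _ , cover , ⊨t , ⊨rest) s s∈ with cover s s∈
    ... | inj₁ s∈₁ = here (⊨-point⇒≐ ⊨t s∈₁)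
    ... | inj₂ s∈₂ = there (to (⊨-points t′ ts) ⊨rest s s∈₂)
    ⊆⇒split : _⊆T_ σ L (t ∷ t′ ∷ ts) → _,_⊨_ σ L 𝓕 (⋁ σ (map point (t ∷ t′ ∷ ts)))
    ⊆⇒split L⊆ =
      ⊨-∨-filter (λ s → ≐? s t) (from ⊨-point (All.all-filter _ L)) (from (⊨-points t′ ts) rest⊆)
      where
      rest⊆ : _⊆T_ σ (filter (∁? (λ s → ≐? s t)) L) (t′ ∷ ts)
      rest⊆ s s∈ with find s∈
      ... | u , u∈ , s≐u with ∈-filter⁻ (∁? (λ s → ≐? s t)) {xs = L} u∈
      ...   | u∈L , u≭t with L⊆ u (∈⇒∈T u∈L)
      ...     | here u≐t = contradiction u≐t u≭t
      ...     | there u∈rest = ∈T-resp-≐ s≐u u∈rest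

  ⊨Θ⇔⊆T : ∀ {L 𝓕} (U : CausalTeam σ) → ¬ team U ≡ [] → _,_⊨_ σ L 𝓕 (Θ σ U) ⇔ _⊆T_ σ L (team U)
  ⊨Θ⇔⊆T U neU with team U
  ... | [] = contradiction refl neU
  ... | t ∷ ts = ⊨-points t ts

  ⊨-□→eq : ∀ {𝓕 L es X} {x : Ran σ X} → Consistent σ es
          → _,_⊨_ σ L 𝓕 (es □→ eq X x) ⇔ All (λ s → intervAsg σ 𝓕 es s X ≡ x) L
  ⊨-□→eq c = mk⇔ [ contradiction c , All.map⁻ ] (inj₂ ∘ All.map⁺)

  ⊨-eq⊃□→eq : ∀ {𝓕 L es X Y} {x : Ran σ X} {y : Ran σ Y} → WellFormed σ 𝓕 → Consistent σ es
             → _,_⊨_ σ L 𝓕 (_⊃_ σ (eq X x) (es □→ eq Y y))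
               ⇔ All (λ s → s X ≡ x → intervAsg σ 𝓕 es s Y ≡ y) L
  ⊨-eq⊃□→eq {𝓕} {L} {es} {X} {Y} {x} {y} wf c = mk⇔ split⇒ ⇒split
    where
    split⇒ : _,_⊨_ σ L 𝓕 (_⊃_ σ (eq X x) (es □→ eq Y y))
           → All (λ s → s X ≡ x → intervAsg σ 𝓕 es s Y ≡ y) L
    split⇒ (L₁ , L₂ , _ , _ , cover , ⊨¬eq , ⊨□→) =
      All.tabulate λ {s} s∈ sX≡x → [ from-L₁ sX≡x , from-L₂ ] (cover s (∈⇒∈T s∈))
      where
      from-L₁ : ∀ {s} → s X ≡ x → _∈T_ σ s L₁ → intervAsg σ 𝓕 es s Y ≡ y
      from-L₁ sX≡x s∈₁ = let u , u∈ , s≐u = find s∈₁ in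
        contradiction (trans (sym (s≐u X)) sX≡x ∷ []) (All.lookup ⊨¬eq u∈)
      from-L₂ : ∀ {s} → _∈T_ σ s L₂ → intervAsg σ 𝓕 es s Y ≡ y
      from-L₂ s∈₂ = let u , u∈ , s≐u = find s∈₂ in
        trans (intervAsg-resp-≐ {𝓕} {es} wf s≐u Y)
              (All.lookup (to (⊨-□→eq {𝓕} {L₂} {es} {Y} {y} c) ⊨□→) u∈)
    ⇒split : All (λ s → s X ≡ x → intervAsg σ 𝓕 es s Y ≡ y) L
           → _,_⊨_ σ L 𝓕 (_⊃_ σ (eq X x) (es □→ eq Y y))
    ⇒split h = ⊨-∨-filter {𝓕} {L} sX≢x? {¬ᶠ eq X x} {es □→ eq Y y}
      (All.map (λ sX≢x → λ { (sX≡x ∷ []) → sX≢x sX≡x }) (All.all-filter sX≢x? L))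
      (from (⊨-□→eq {𝓕} {filter (∁? sX≢x?) L} {es} {Y} {y} c) (All.tabulate λ s∈ →
         let s∈L , ¬sX≢x = ∈-filter⁻ (∁? sX≢x?) {xs = L} s∈ in
         All.lookup h s∈L (decidable-stable (_ ≟ x) ¬sX≢x)))
      where
      sX≢x? = λ (s : Asg σ) → ¬? (s X ≟ x)

  ⊨-η : ∀ {L 𝓕 𝓖 V} → _,_⊨_ σ L 𝓕 (η σ 𝓖 V)
        ⇔ (∀ {a} → a ∈ allAsg σ → All (λ s → intervAsg σ 𝓕 (ηEqns 𝓖 V a) s V ≡ F 𝓖 V a) L)
  ⊨-η {𝓖 = 𝓖} {V} = mk⇔
    (λ ⊨η {a} a∈ →
       to (⊨-□→eq (ηEqns-consistent 𝓖 V a)) (All.lookup (All.map⁻ (to (⊨-⋀ _ a₀∈) ⊨η)) a∈))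
    (λ h → from (⊨-⋀ _ a₀∈) (All.map⁺ (All.tabulate λ {a} a∈ →
       from (⊨-□→eq (ηEqns-consistent 𝓖 V a)) (h a∈))))
    where
    a₀∈ = ∈-map⁺ (λ a → ηEqns 𝓖 V a □→ eq V (F 𝓖 V a)) (proj₂ allAsg-nonempty)

  ξ-element : (V : Var σ) → Ran σ V → Asg σ → Fm σ
  ξ-element V v a = _⊃_ σ (eq V v) (ξEqns V a □→ eq V v)

  ⊨-ξ-elements : ∀ {𝓕 L V} → _,_⊨_ σ L 𝓕 (ξ σ V)
                 ⇔ (∀ v {a} → a ∈ allAsg σ → _,_⊨_ σ L 𝓕 (ξ-element V v a))
  ⊨-ξ-elements {𝓕} {L} {V} = mk⇔ conj⇒elements elements⇒conj
    where
    row : Ran σ V → List (Fm σ)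
    row v = map (ξ-element V v) (allAsg σ)
    elements : List (Fm σ)
    elements = concatMap row (allFin (suc (r V)))
    ξ₀∈ : ξ-element V zero (proj₁ allAsg-nonempty) ∈ elements
    ξ₀∈ = ∈-concatMap⁺ row (Any.map (λ { refl → ∈-map⁺ (ξ-element V zero) (proj₂ allAsg-nonempty) })
                                    (∈-allFin zero))
    conj⇒elements : _,_⊨_ σ L 𝓕 (ξ σ V) → ∀ v {a} → a ∈ allAsg σ → _,_⊨_ σ L 𝓕 (ξ-element V v a)
    conj⇒elements ⊨ξ v = All.lookup (All.map⁻ (All.lookup (All.map⁻ {xs = allFin (suc (r V))}
                                                             (All.concat⁻ (to (⊨-⋀ elements ξ₀∈) ⊨ξ)))
                                                (∈-allFin v)))
    elements⇒conj : (∀ v {a} → a ∈ allAsg σ → _,_⊨_ σ L 𝓕 (ξ-element V v a)) → _,_⊨_ σ L 𝓕 (ξ σ V)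
    elements⇒conj ⊨elements = from (⊨-⋀ elements ξ₀∈)
      (All.concat⁺ (All.map⁺ {xs = allFin (suc (r V))} {f = row} (All.tabulate λ {v} _ →
         All.map⁺ {f = ξ-element V v} (All.tabulate (⊨elements v)))))

  ⊨-ξ : ∀ {𝓕 L V} → WellFormed σ 𝓕
      → _,_⊨_ σ L 𝓕 (ξ σ V)
        ⇔ (∀ {a} → a ∈ allAsg σ → All (λ s → intervAsg σ 𝓕 (ξEqns V a) s V ≡ s V) L)
  ⊨-ξ {V = V} wf = mk⇔
    (λ ⊨ξ {a} a∈ → All.tabulate λ {s} s∈ →
       All.lookup (to (⊨-eq⊃□→eq wf (ξEqns-consistent V a)) (to ⊨-ξ-elements ⊨ξ (s V) a∈)) s∈ refl)
    (λ unchanged → from ⊨-ξ-elements λ v {a} a∈ →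
       from (⊨-eq⊃□→eq wf (ξEqns-consistent V a))
            (All.map (λ unchangedₛ → trans unchangedₛ) (unchanged a∈)))

  ⊨-Φ : ∀ {L 𝓕 𝓖} → _,_⊨_ σ L 𝓕 (Φ σ 𝓖)
        ⇔ ( (∀ V → T (En 𝓖 V) → _,_⊨_ σ L 𝓕 (η σ 𝓖 V))
          × (∀ V → T (exoOrConst 𝓖 V) → _,_⊨_ σ L 𝓕 (ξ σ V)))
  ⊨-Φ {L} {𝓕} {𝓖} = mk⇔
    (λ ⊨Φ → let ⊨all = to (⊨-⋀ _ (proj₂ member)) ⊨Φ in
       (λ V en → All.lookup (All.map⁻ (All.++⁻ˡ ηs ⊨all)) (from (∈-varsWhere (En 𝓖)) en)) ,
       (λ V eoc → All.lookup (All.map⁻ (All.++⁻ʳ ηs ⊨all)) (from (∈-varsWhere (exoOrConst 𝓖)) eoc)))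
    (λ (⊨η , ⊨ξ) → from (⊨-⋀ _ (proj₂ member))
       (All.++⁺ (All.map⁺ (All.tabulate λ V∈ → ⊨η _ (to (∈-varsWhere (En 𝓖)) V∈)))
                (All.map⁺ (All.tabulate λ V∈ → ⊨ξ _ (to (∈-varsWhere (exoOrConst 𝓖)) V∈)))))
    where
    ηs = map (η σ 𝓖) (varsWhere σ (En 𝓖))
    member : ∃ (_∈ ηs ++ map (ξ σ) (varsWhere σ (exoOrConst 𝓖)))
    member with T? (En 𝓖 zero)
    ... | yes en = _ , ∈-++⁺ˡ (∈-map⁺ (η σ 𝓖) (from (∈-varsWhere (En 𝓖)) en))
    ... | no exo =
      _ , ∈-++⁺ʳ ηs (∈-map⁺ (ξ σ) (from (∈-varsWhere (exoOrConst 𝓖)) (exoOrConst-exo {𝓖} exo)))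

  -- u takes the 𝓕-parents of V from s and all other values from t, so it agrees with t on the
  -- 𝓖-parents.
  agree-on-allAsg⇒∼V : ∀ {𝓕 𝓖 V} → WellFormed σ 𝓕 → WellFormed σ 𝓖 → T (En 𝓕 V) → T (En 𝓖 V)
                     → (∀ {a} → a ∈ allAsg σ → F 𝓕 V a ≡ F 𝓖 V a) → _∼V_at_ σ 𝓕 𝓖 V
  agree-on-allAsg⇒∼V {𝓕} {𝓖} {V} wf𝓕@(_ , local𝓕) wf𝓖@(_ , local𝓖) en𝓕 en𝓖 agree s t common = begin
    F 𝓕 V s ≡⟨ local𝓕 V en𝓕 s u (λ X X∈PA𝓕 → sym (u-on-PA𝓕 X X∈PA𝓕)) ⟩
    F 𝓕 V u ≡⟨ agree-everywhere ⟩
    F 𝓖 V u ≡⟨ local𝓖 V en𝓖 u t u-on-PA𝓖 ⟩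
    F 𝓖 V t ∎
    where
    open ≡-Reasoning
    u : Asg σ
    u X = if PA 𝓕 V X then s X else t X
    u-on-PA𝓕 : ∀ X → T (PA 𝓕 V X) → u X ≡ s X
    u-on-PA𝓕 X X∈PA𝓕 rewrite to T-≡ X∈PA𝓕 = refl
    u-on-PA𝓖 : ∀ X → T (PA 𝓖 V X) → u X ≡ t X
    u-on-PA𝓖 X X∈PA𝓖 with PA 𝓕 V X in X∈?PA𝓕
    ... | true = common X (from T-≡ X∈?PA𝓕) X∈PA𝓖
    ... | false = refl
    agree-everywhere : F 𝓕 V u ≡ F 𝓖 V u
    agree-everywhere = let u′ , u′∈ , u≐u′ = find (∈T-allAsg u) in
      trans (F-resp-≐ wf𝓕 en𝓕 u≐u′) (trans (agree u′∈) (sym (F-resp-≐ wf𝓖 en𝓖 u≐u′)))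

  ∼⇒⊨Φ : (S U : CausalTeam σ) → _∼_ σ (sys S) (sys U) → _⊆T_ σ (team S) (team U)
       → _,_⊨_ σ (team S) (sys S) (Φ σ (sys U))
  ∼⇒⊨Φ S U (nonConst≡ , similar) S⊆U = from (⊨-Φ {team S} {sys S} {sys U}) (⊨η , ⊨ξ)
    where
    unchanged : ∀ {V es a s} → T (exoOrConst (sys U) V) → FixesAllBut es V a → s ∈ team S
              → intervAsg σ (sys S) es s V ≡ s V
    unchanged {V} eoc fixes s∈ = intervAsg-exoOrConst {sys S} (wf S) (All.lookup (compat S) s∈)
      (subst T (sym (to (nonConst≡⇔exoOrConst≡ {sys S} {sys U}) (nonConst≡ V))) eoc) fixes
    ⊨η : ∀ V → T (En (sys U) V) → _,_⊨_ σ (team S) (sys S) (η σ (sys U) V)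
    ⊨η V en = from (⊨-η {team S} {sys S} {sys U}) λ {a} _ → All.tabulate (η-value a)
      where
      fixes : ∀ a → FixesAllBut (ηEqns (sys U) V a) V a
      fixes a = ηEqns-fixesAllBut {sys U} (proj₁ (wf U) V en)
      η-value : ∀ a {s} → s ∈ team S → intervAsg σ (sys S) (ηEqns (sys U) V a) s V ≡ F (sys U) V a
      η-value a s∈ with T? (exoOrConst (sys U) V)
      ... | yes eoc = trans (unchanged eoc (fixes a) s∈)
                            (compatible-constant a (wf U) (∈T⇒Compatible U (S⊆U _ (∈⇒∈T s∈))) en
                                                 (exoOrConst⇒isConst {sys U} en eoc))
      ... | no ¬eoc = trans (intervAsg-endogenous (wf S) (fixes a) (proj₁ (to T-∧ nonConstS)))
                            (similar V nonConstS a a (λ _ _ _ → refl))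
        where
        nonConstS : T (nonConst σ (sys S) V)
        nonConstS = subst T (sym (nonConst≡ V)) (from (T-nonConst {sys U}) ¬eoc)
    ⊨ξ : ∀ V → T (exoOrConst (sys U) V) → _,_⊨_ σ (team S) (sys S) (ξ σ V)
    ⊨ξ V eoc = from (⊨-ξ (wf S)) λ _ → All.tabulate (unchanged eoc ξEqns-fixesAllBut)

  module _ (S U : CausalTeam σ) {s₀ : Asg σ} (s₀∈ : s₀ ∈ team S)
           (⊨Φ : _,_⊨_ σ (team S) (sys S) (Φ σ (sys U))) where
    private
      𝓢 = sys S
      𝓤 = sys U
      ηFixes : ∀ {V a} → T (En 𝓤 V) → FixesAllBut (ηEqns 𝓤 V a) V a
      ηFixes en = ηEqns-fixesAllBut {𝓤} (proj₁ (wf U) _ en)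
      probe-η : ∀ {V a} → T (En 𝓤 V) → a ∈ allAsg σ → intervAsg σ 𝓢 (ηEqns 𝓤 V a) s₀ V ≡ F 𝓤 V a
      probe-η {V} en a∈ =
        All.lookup (to (⊨-η {team S} {𝓢} {𝓤}) (proj₁ (to (⊨-Φ {team S} {𝓢} {𝓤}) ⊨Φ) V en) a∈) s₀∈
      probe-ξ : ∀ {V a} → T (exoOrConst 𝓤 V) → a ∈ allAsg σ → intervAsg σ 𝓢 (ξEqns V a) s₀ V ≡ s₀ V
      probe-ξ {V} eoc a∈ =
        All.lookup (to (⊨-ξ (wf S)) (proj₂ (to (⊨-Φ {team S} {𝓢} {𝓤}) ⊨Φ) V eoc) a∈) s₀∈

    ⊨Φ⇒laws-agree : ∀ {V a} → T (En 𝓤 V) → T (En 𝓢 V) → a ∈ allAsg σ → F 𝓢 V a ≡ F 𝓤 V a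
    ⊨Φ⇒laws-agree enU enS a∈ =
      trans (sym (intervAsg-endogenous (wf S) (ηFixes enU) enS)) (probe-η enU a∈)

    ⊨Φ⇒law-constant : ∀ {V a} → T (En 𝓤 V) → ¬ T (En 𝓢 V) → a ∈ allAsg σ → F 𝓤 V a ≡ s₀ V
    ⊨Φ⇒law-constant enU exoS a∈ =
      trans (sym (probe-η enU a∈)) (intervAsg-exogenous {𝓢} (ηFixes enU) exoS)

    ⊨Φ⇒exoOrConst-law-constant : ∀ {V a} → T (exoOrConst 𝓤 V) → T (En 𝓢 V) → a ∈ allAsg σ
                               → F 𝓢 V a ≡ s₀ V
    ⊨Φ⇒exoOrConst-law-constant eoc enS a∈ =
      trans (sym (intervAsg-endogenous (wf S) ξEqns-fixesAllBut enS)) (probe-ξ eoc a∈)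

    ⊨Φ⇒exoOrConst⇔ : ∀ V → T (exoOrConst 𝓢 V) ⇔ T (exoOrConst 𝓤 V)
    ⊨Φ⇒exoOrConst⇔ V = mk⇔ S⇒U U⇒S
      where
      S⇒U : T (exoOrConst 𝓢 V) → T (exoOrConst 𝓤 V)
      S⇒U eocS with T? (En 𝓤 V) | T? (En 𝓢 V)
      ... | no exoU | _ = exoOrConst-exo {𝓤} exoU
      ... | yes enU | no exoS =
        isConst⇒exoOrConst {𝓤} (isConst-intro {𝓤} (s₀ V) (⊨Φ⇒law-constant enU exoS))
      ... | yes enU | yes enS = isConst⇒exoOrConst {𝓤} (isConst-intro {𝓤} (F 𝓢 V s₀) λ a∈ →
        trans (sym (⊨Φ⇒laws-agree enU enS a∈))
              (isConst⇒constant (wf S) enS (exoOrConst⇒isConst {𝓢} enS eocS) _ s₀))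
      U⇒S : T (exoOrConst 𝓤 V) → T (exoOrConst 𝓢 V)
      U⇒S eocU with T? (En 𝓢 V)
      ... | no exoS = exoOrConst-exo {𝓢} exoS
      ... | yes enS =
        isConst⇒exoOrConst {𝓢} (isConst-intro {𝓢} (s₀ V) (⊨Φ⇒exoOrConst-law-constant eocU enS))

  ⊨Φ⇒∼ : (S U : CausalTeam σ) → ¬ team S ≡ [] → _,_⊨_ σ (team S) (sys S) (Φ σ (sys U))
       → _∼_ σ (sys S) (sys U)
  ⊨Φ⇒∼ S U neS ⊨Φ = nonConst≡ , similar
    where
    s₀∈ = proj₂ (≢[]⇒∃∈ neS)
    nonConst≡ : ∀ V → nonConst σ (sys S) V ≡ nonConst σ (sys U) V
    nonConst≡ V = from (nonConst≡⇔exoOrConst≡ {sys S} {sys U}) (T-⇔⇒≡ (⊨Φ⇒exoOrConst⇔ S U s₀∈ ⊨Φ V))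
    similar : ∀ V → T (nonConst σ (sys S) V) → _∼V_at_ σ (sys S) (sys U) V
    similar V ncS = agree-on-allAsg⇒∼V (wf S) (wf U) enS enU (⊨Φ⇒laws-agree S U s₀∈ ⊨Φ enU enS)
      where
      enS = proj₁ (to T-∧ ncS)
      enU = proj₁ (to T-∧ (subst T (nonConst≡ V) ncS))

  restrict : (U : CausalTeam σ) (L : List (Asg σ)) → _⊆T_ σ L (team U) → CausalTeam σ
  restrict U L L⊆U = record
    { team = L ; sys = sys U ; wf = wf U ; rec = rec U
    ; compat = All.tabulate λ s∈ → ∈T⇒Compatible U (L⊆U _ (∈⇒∈T s∈)) }

lemma4p5 : (σ : Signature) (S U : CausalTeam σ)
    → ¬ (team S ≡ []) → ¬ (team U ≡ [])
    → (_,_⊨_ σ (team S) (sys S) (_∧ᶠ_ (Θ σ U) (Φ σ (sys U))))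
    ⇔ (Σ (CausalTeam σ) λ R → _≈_ σ S R × Subteam σ R U)
lemma4p5 σ S U neS neU = mk⇔
  (λ (⊨Θ , ⊨Φ) → let S⊆U = to (⊨Θ⇔⊆T σ U neU) ⊨Θ in
     restrict σ U (team S) S⊆U , (⊨Φ⇒∼ σ S U neS ⊨Φ , ⊆T-refl σ , ⊆T-refl σ) , refl , S⊆U)
  (λ (R , (S∼R , S⊆R , _) , sysR≡sysU , R⊆U) → let S⊆U = ⊆T-trans σ S⊆R R⊆U in
     from (⊨Θ⇔⊆T σ U neU) S⊆U , ∼⇒⊨Φ σ S U (subst (_∼_ σ (sys S)) sysR≡sysU S∼R) S⊆U)
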